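{- Let $\alpha$ be a positive integer and $n=p^\alpha$ with $p$ a prime, $p\equiv1\pmod4$. Let $G(p)$ be the Paley graph of order $p$. Then $G_n$ contains a copy of $G(p)$; more precisely, $$G_n=\bigoplus_{i=1}^{p^{\alpha-1}}G(p)\ \bigoplus\ \left(\bigoplus_{j=1}^{\frac{p^{\alpha-1}(p^{\alpha-1}-1)}{2}}\left(\bigoplus_{m=1}^{p}K_{1,\frac{p-1}{2}}\right)\right),$$ where $K_{1,\frac{p-1}{2}}$ is the complete bipartite graph (star) with parts of sizes $1$ and $\frac{p-1}{2}$.
   Context: The graph $G_n$ has vertex set $\mathbb{Z}_n$, and distinct $a,b$ are adjacent iff $a-b\equiv x^2\pmod n$ for some unit $x\in\mathbb{Z}_n^{\ast}$. The Paley graph $G(p)$ has vertex set $\mathbb{F}_p$ with $a,b$ adjacent iff $a-b$ is a nonzero square in $\mathbb{F}_p$. Notation: if $\{G_i\}_{i\in I}$ is a family of pairwise edge-disjoint subgraphs of $G$ with $E(G)=\bigcup_{i\in I}E(G_i)$, one writes $G=\bigoplus_{i\in I}G_i$; writing a graph $H$ in place of $G_i$ means that $G_i\cong H$. -}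

module Defs where

open import Data.Nat as ℕ using (ℕ; suc; _∸_; _^_)
open import Data.Nat.Coprimality using (Coprime)
open import Data.Fin using (Fin; toℕ; zero)
open import Data.Integer as ℤ using (ℤ; +_)
open import Data.Integer.Divisibility using (_∣_)
open import Data.Product using (Σ; ∃; ∃-syntax; _×_)
open import Data.Sum using (_⊎_)
open import Relation.Binary.PropositionalEquality using (_≡_; _≢_)
open import Relation.Nullary using (¬_)

Graph : Set → Set₁
Graph V = V → V → Set

_≡_[mod_] : ℤ → ℤ → ℕ → Set
a ≡ b [mod n ] = (+ n) ∣ (a ℤ.- b)

-- G_n : vertex set ℤ_n (represented by Fin n); distinct a, b adjacent iff
-- a - b ≡ x² (mod n) for some unit x of ℤ_n (x coprime to n).
Gₙ : (n : ℕ) → Graph (Fin n)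
Gₙ n a b = (a ≢ b) × (∃[ x ] (Coprime x n × ((+ toℕ a) ℤ.- (+ toℕ b)) ≡ + (x ℕ.* x) [mod n ]))

Paley : (p : ℕ) → Graph (Fin p)
Paley p a b = (a ≢ b) × (∃[ x ] (((+ toℕ a) ℤ.- (+ toℕ b)) ≡ + (x ℕ.* x) [mod p ]))

Star : (m : ℕ) → Graph (Fin (suc m))
Star m u v = (u ≡ zero × v ≢ zero) ⊎ (v ≡ zero × u ≢ zero)

SameEdge : {V : Set} → V → V → V → V → Set
SameEdge a b c d = (a ≡ c × b ≡ d) ⊎ (a ≡ d × b ≡ c)

record Copy {W V : Set} (H : Graph W) (G : Graph V) : Set where
  field
    f        : W → V
    f-inj    : ∀ u v → f u ≡ f v → u ≡ v
    f-edge   : ∀ u v → H u v → G (f u) (f v)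

-- G = ⊕_{i ∈ I} G_i with G_i ≅ H i: pairwise edge-disjoint copies whose edges cover E(G).
record Decomposition {V I : Set} (G : Graph V) (W : I → Set) (H : (i : I) → Graph (W i)) : Set where
  field
    copy     : (i : I) → Copy (H i) G
  open Copy
  field
    cover    : ∀ a b → G a b →
               Σ I λ i → ∃[ u ] ∃[ v ] (H i u v × f (copy i) u ≡ a × f (copy i) v ≡ b)
    disjoint : ∀ i j u v u' v' → H i u v → H j u' v' →
               SameEdge (f (copy i) u) (f (copy i) v) (f (copy j) u') (f (copy j) v') →
               i ≡ j

open import Data.Sum using (inj₁; inj₂)
open import Data.Nat using (_/_)

Index37 : ℕ → ℕ → Set
Index37 p α = Fin (p ^ (α ∸ 1)) ⊎ (Fin ((p ^ (α ∸ 1) ℕ.* (p ^ (α ∸ 1) ∸ 1)) / 2) × Fin p)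

Vert37 : (p α : ℕ) → Index37 p α → Set
Vert37 p α (inj₁ _) = Fin p
Vert37 p α (inj₂ _) = Fin (suc ((p ∸ 1) / 2))

Piece37 : (p α : ℕ) → (i : Index37 p α) → Graph (Vert37 p α i)
Piece37 p α (inj₁ _) = Paley p
Piece37 p α (inj₂ _) = Star ((p ∸ 1) / 2)

-- Write a vertex of ℤ/p^α as p k + r, with layer k < p^(α-1) and residue r < p.
-- By Hensel's lemma (p is odd) a difference is the square of a unit modulo p^α
-- iff it is a nonzero square modulo p, so two vertices of G_n are adjacent iff
-- their residues differ by a nonzero square modulo p.  Hence every layer spans a
-- copy of G(p); and since -1 is a square modulo p ≡ 1 (mod 4), the edges between
-- two layers k < l split into the p stars with centre p k + r and leaves
-- p l + (r + j² mod p), 1 ≤ j ≤ (p-1)/2.  That -1 is a square comes from pairing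
-- each j in {1,…,h}, h = (p-1)/2, with the j′ such that j j′ ≡ ±1: this involution
-- fixes 1, and as h is even it has a second fixed point j, for which j² ≡ -1.

module Submission where

open import Defs
open import Data.Nat using (ℕ; _^_; _%_; _≤_; _<_)
open import Data.Nat.Primality using (Prime)
open import Relation.Binary.PropositionalEquality using (_≡_)

open import Data.Nat as ℕ using (zero; suc; NonZero; z≤n; s≤s; _∸_)
import Data.Nat.Properties as ℕ
import Data.Nat.Divisibility as ℕ
open import Data.Nat.DivMod using (m≡m%n+[m/n]*n; m*n/n≡m)
open import Data.Nat.Coprimality using (Coprime; coprime-Bézout; coprime-divisor)
open import Data.Nat.GCD using (module Bézout)
open import Data.Nat.Primality using (euclidsLemma; prime⇒irreducible; prime⇒nonZero; ¬prime[1])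
import Data.Nat.Tactic.RingSolver as NatSolver
open import Data.Integer as ℤ using (ℤ; +_; _+_; _*_; _-_; -_; _%ℕ_; 0ℤ; 1ℤ; -1ℤ)
import Data.Integer.Properties as ℤ
open import Data.Integer.DivMod using (a≡a%ℕn+[a/ℕn]*n; n%ℕd<d)
open import Data.Integer.Divisibility.Signed
  using (_∣_; divides; ∣ᵤ⇒∣; ∣⇒∣ᵤ; ∣-trans; ∣m∣n⇒∣m+n; ∣m⇒∣-m; ∣m⇒∣m*n; ∣n⇒∣m*n
        ; ∣m+n∣n⇒∣m)
open import Data.Integer.Tactic.RingSolver using (solve-∀)
open import Data.Fin as Fin
  using (Fin; zero; suc; toℕ; fromℕ<; fromℕ; inject₁; cast; splitAt; join; _↑ˡ_; _↑ʳ_; combine; remQuot)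
import Data.Fin.Properties as Fin
open import Data.List using (List; []; _∷_; length; filter; allFin)
open import Data.List.Properties using (filter-all; filter-accept; filter-reject; length-tabulate)
open import Data.List.Membership.Propositional using (_∈_)
open import Data.List.Membership.Propositional.Properties using (∈-filter⁺; ∈-filter⁻; ∈-allFin)
open import Data.List.Relation.Unary.Any using (here; there)
import Data.List.Relation.Unary.All as All
open import Data.List.Relation.Unary.All using (lookup)
open import Data.List.Relation.Unary.AllPairs using (_∷_)
open import Data.List.Relation.Unary.Unique.Propositional using (Unique)
import Data.List.Relation.Unary.Unique.Propositional.Properties as Unique
open import Data.Product using (Σ; ∃-syntax; _×_; _,_; proj₁; proj₂; map₂; swap)
open import Data.Sum as Sum using (_⊎_; inj₁; inj₂; [_,_])
open import Data.Empty using (⊥-elim)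
open import Function using (_∘_)
open import Relation.Nullary using (¬_; yes; no; ¬?)
open import Level using (0ℓ)
open import Relation.Binary.Bundles using (Setoid)
open import Relation.Binary.Definitions using (DecidableEquality; tri<; tri≈; tri>)
open import Relation.Binary.PropositionalEquality
  using (_≢_; refl; sym; trans; cong; cong₂; subst; subst₂; module ≡-Reasoning)

private
  ∣-respʳ : ∀ {k a b} → a ≡ b → k ∣ a → k ∣ b
  ∣-respʳ refl k∣a = k∣a

-- a ≡ b [mod n ] wrapped in a record (over signed divisibility), so that a, b
-- and n can be inferred from a proof.
infix 4 _≡_⟨mod_⟩
record _≡_⟨mod_⟩ (a b : ℤ) (n : ℕ) : Set where
  constructor mod-divides
  field divides-difference : + n ∣ a - b
open _≡_⟨mod_⟩ public

module _ {n : ℕ} where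

  ≡mod-refl : ∀ {a} → a ≡ a ⟨mod n ⟩
  ≡mod-refl {a} = mod-divides (∣-respʳ (sym (ℤ.+-inverseʳ a)) (divides 0ℤ refl))

  ≡mod-reflexive : ∀ {a b} → a ≡ b → a ≡ b ⟨mod n ⟩
  ≡mod-reflexive refl = ≡mod-refl

  ≡mod-sym : ∀ {a b} → a ≡ b ⟨mod n ⟩ → b ≡ a ⟨mod n ⟩
  ≡mod-sym {a} {b} (mod-divides d) = mod-divides (∣-respʳ (lemma a b) (∣m⇒∣-m d))
    where lemma : ∀ a b → - (a - b) ≡ b - a
          lemma = solve-∀

  ≡mod-trans : ∀ {a b c} → a ≡ b ⟨mod n ⟩ → b ≡ c ⟨mod n ⟩ → a ≡ c ⟨mod n ⟩
  ≡mod-trans {a} {b} {c} (mod-divides d) (mod-divides d′) =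
    mod-divides (∣-respʳ (lemma a b c) (∣m∣n⇒∣m+n d d′))
    where lemma : ∀ a b c → (a - b) + (b - c) ≡ a - c
          lemma = solve-∀

  ≡mod-setoid : Setoid 0ℓ 0ℓ
  ≡mod-setoid = record
    { Carrier = ℤ
    ; _≈_ = λ a b → a ≡ b ⟨mod n ⟩
    ; isEquivalence = record { refl = ≡mod-refl ; sym = ≡mod-sym ; trans = ≡mod-trans }
    }

  ≡mod-+ : ∀ {a b c d} → a ≡ b ⟨mod n ⟩ → c ≡ d ⟨mod n ⟩ → a + c ≡ b + d ⟨mod n ⟩
  ≡mod-+ {a} {b} {c} {d} (mod-divides d₁) (mod-divides d₂) =
    mod-divides (∣-respʳ (lemma a b c d) (∣m∣n⇒∣m+n d₁ d₂))
    where lemma : ∀ a b c d → (a - b) + (c - d) ≡ (a + c) - (b + d)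
          lemma = solve-∀

  ≡mod-neg : ∀ {a b} → a ≡ b ⟨mod n ⟩ → - a ≡ - b ⟨mod n ⟩
  ≡mod-neg {a} {b} (mod-divides d) = mod-divides (∣-respʳ (lemma a b) (∣m⇒∣-m d))
    where lemma : ∀ a b → - (a - b) ≡ (- a) - (- b)
          lemma = solve-∀

  ≡mod-* : ∀ {a b c d} → a ≡ b ⟨mod n ⟩ → c ≡ d ⟨mod n ⟩ → a * c ≡ b * d ⟨mod n ⟩
  ≡mod-* {a} {b} {c} {d} (mod-divides d₁) (mod-divides d₂) =
    mod-divides (∣-respʳ (lemma a b c d) (∣m∣n⇒∣m+n (∣m⇒∣m*n c d₁) (∣n⇒∣m*n b d₂)))
    where lemma : ∀ a b c d → (a - b) * c + b * (c - d) ≡ (a * c) - (b * d)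
          lemma = solve-∀

  ≡mod-+ˡ : ∀ c {a b} → a ≡ b ⟨mod n ⟩ → c + a ≡ c + b ⟨mod n ⟩
  ≡mod-+ˡ c = ≡mod-+ (≡mod-refl {c})

  ≡mod-+ʳ : ∀ c {a b} → a ≡ b ⟨mod n ⟩ → a + c ≡ b + c ⟨mod n ⟩
  ≡mod-+ʳ c a≡b = ≡mod-+ a≡b (≡mod-refl {c})

  ≡mod-*ʳ : ∀ c {a b} → a ≡ b ⟨mod n ⟩ → a * c ≡ b * c ⟨mod n ⟩
  ≡mod-*ʳ c a≡b = ≡mod-* a≡b (≡mod-refl {c})

  ≡mod-*ˡ : ∀ c {a b} → a ≡ b ⟨mod n ⟩ → c * a ≡ c * b ⟨mod n ⟩
  ≡mod-*ˡ c = ≡mod-* (≡mod-refl {c})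

  +-*-≡mod : ∀ a q → a + q * + n ≡ a ⟨mod n ⟩
  +-*-≡mod a q = mod-divides (∣-respʳ (lemma a q (+ n)) (divides q refl))
    where lemma : ∀ a q n → q * n ≡ (a + q * n) - a
          lemma = solve-∀

  ∣⇒≡mod-0 : ∀ {a} → + n ∣ a → a ≡ 0ℤ ⟨mod n ⟩
  ∣⇒≡mod-0 {a} d = mod-divides (∣-respʳ (sym (ℤ.+-identityʳ a)) d)

  ≡mod-0⇒∣ : ∀ {a} → a ≡ 0ℤ ⟨mod n ⟩ → + n ∣ a
  ≡mod-0⇒∣ {a} (mod-divides d) = ∣-respʳ (ℤ.+-identityʳ a) d

  ≡mod-∣ : ∀ {a b} → a ≡ b ⟨mod n ⟩ → + n ∣ b → + n ∣ a
  ≡mod-∣ a≡b n∣b = ≡mod-0⇒∣ (≡mod-trans a≡b (∣⇒≡mod-0 n∣b))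

  %ℕ-≡mod : .{{_ : NonZero n}} → ∀ a → + (a %ℕ n) ≡ a ⟨mod n ⟩
  %ℕ-≡mod a = ≡mod-sym (subst (_≡ + (a %ℕ n) ⟨mod n ⟩) (sym (a≡a%ℕn+[a/ℕn]*n a n))
                (+-*-≡mod (+ (a %ℕ n)) (a ℤ./ℕ n)))

  ≡mod⇒≡[mod] : ∀ {a b} → a ≡ b ⟨mod n ⟩ → a ≡ b [mod n ]
  ≡mod⇒≡[mod] = ∣⇒∣ᵤ ∘ divides-difference

  ≡[mod]⇒≡mod : ∀ {a b} → a ≡ b [mod n ] → a ≡ b ⟨mod n ⟩
  ≡[mod]⇒≡mod = mod-divides ∘ ∣ᵤ⇒∣

  ≡mod-weaken : ∀ {m a b} → m ℕ.∣ n → a ≡ b ⟨mod n ⟩ → a ≡ b ⟨mod m ⟩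
  ≡mod-weaken m∣n (mod-divides d) = mod-divides (∣-trans (∣ᵤ⇒∣ m∣n) d)

  ≡mod-*-modulus : ∀ {a b} m → a ≡ b ⟨mod n ⟩ → a * + m ≡ b * + m ⟨mod n ℕ.* m ⟩
  ≡mod-*-modulus {a} {b} m (mod-divides (divides q a-b≡qn)) = mod-divides (divides q (begin
    a * + m - b * + m    ≡⟨ distrib a b (+ m) ⟩
    (a - b) * + m        ≡⟨ cong (_* + m) a-b≡qn ⟩
    q * + n * + m        ≡⟨ ℤ.*-assoc q (+ n) (+ m) ⟩
    q * (+ n * + m)      ≡⟨ cong (q *_) (ℤ.pos-* n m) ⟨
    q * + (n ℕ.* m)      ∎))
    where
    open ≡-Reasoning
    distrib : ∀ a b m → a * m - b * m ≡ (a - b) * m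
    distrib = solve-∀

  ≡mod⇒≡ : ∀ {x y} → x ℕ.< n → y ℕ.< n → + x ≡ + y ⟨mod n ⟩ → x ≡ y
  ≡mod⇒≡ {x} {y} x<n y<n (mod-divides n∣x-y) = ℤ.+-injective (begin
    + x                  ≡⟨ lemma (+ x) (+ y) ⟩
    (+ x - + y) + + y    ≡⟨ cong (_+ + y) (small-multiple (+ x - + y) ∣x-y∣<n n∣x-y) ⟩
    0ℤ + + y             ≡⟨ ℤ.+-identityˡ (+ y) ⟩
    + y                  ∎)
    where
    open ≡-Reasoning
    lemma : ∀ a b → a ≡ (a - b) + b
    lemma = solve-∀
    small-multiple : ∀ z → ℤ.∣ z ∣ ℕ.< n → + n ∣ z → z ≡ 0ℤ
    small-multiple z ∣z∣<n n∣z with ℤ.∣ z ∣ in ∣z∣≡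
    ... | zero = ℤ.∣i∣≡0⇒i≡0 ∣z∣≡
    ... | suc _ = ⊥-elim (ℕ.>⇒∤ ∣z∣<n (subst (n ℕ.∣_) ∣z∣≡ (∣⇒∣ᵤ n∣z)))
    ∣x-y∣<n : ℤ.∣ + x - + y ∣ ℕ.< n
    ∣x-y∣<n with ℕ.≤-total x y
    ... | inj₁ x≤y = subst (ℕ._< n) (sym (trans (cong ℤ.∣_∣ (ℤ.m-n≡m⊖n x y)) (ℤ.∣⊖∣-≤ x≤y)))
                       (ℕ.≤-<-trans (ℕ.m∸n≤m y x) y<n)
    ... | inj₂ y≤x = subst (ℕ._< n)
                       (sym (trans (cong ℤ.∣_∣ (ℤ.m-n≡m⊖n x y))
                                   (trans (ℤ.∣m⊖n∣≡∣n⊖m∣ x y) (ℤ.∣⊖∣-≤ y≤x))))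
                       (ℕ.≤-<-trans (ℕ.m∸n≤m x y) x<n)

module ≡mod-Reasoning (n : ℕ) where
  open import Relation.Binary.Reasoning.Setoid (≡mod-setoid {n}) public

infix 4 _≡±_⟨mod_⟩
_≡±_⟨mod_⟩ : ℤ → ℤ → ℕ → Set
a ≡± b ⟨mod n ⟩ = a ≡ b ⟨mod n ⟩ ⊎ a ≡ - b ⟨mod n ⟩

module _ {n : ℕ} where

  ≡±-sym : ∀ {a b} → a ≡± b ⟨mod n ⟩ → b ≡± a ⟨mod n ⟩
  ≡±-sym (inj₁ a≡b) = inj₁ (≡mod-sym a≡b)
  ≡±-sym (inj₂ a≡-b) =
    inj₂ (≡mod-trans (≡mod-reflexive (sym (ℤ.neg-involutive _))) (≡mod-neg (≡mod-sym a≡-b)))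

  ≡±-trans : ∀ {a b c} → a ≡± b ⟨mod n ⟩ → b ≡± c ⟨mod n ⟩ → a ≡± c ⟨mod n ⟩
  ≡±-trans (inj₁ a≡b) (inj₁ b≡c) = inj₁ (≡mod-trans a≡b b≡c)
  ≡±-trans (inj₁ a≡b) (inj₂ b≡-c) = inj₂ (≡mod-trans a≡b b≡-c)
  ≡±-trans (inj₂ a≡-b) (inj₁ b≡c) = inj₂ (≡mod-trans a≡-b (≡mod-neg b≡c))
  ≡±-trans (inj₂ a≡-b) (inj₂ b≡-c) =
    inj₁ (≡mod-trans a≡-b (≡mod-trans (≡mod-neg b≡-c) (≡mod-reflexive (ℤ.neg-involutive _))))

  ≡±-*ˡ : ∀ c {a b} → a ≡± b ⟨mod n ⟩ → c * a ≡± c * b ⟨mod n ⟩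
  ≡±-*ˡ c (inj₁ a≡b) = inj₁ (≡mod-*ˡ c a≡b)
  ≡±-*ˡ c {b = b} (inj₂ a≡-b) =
    inj₂ (≡mod-trans (≡mod-*ˡ c a≡-b) (≡mod-reflexive (sym (ℤ.neg-distribʳ-* c b))))

  ≡±⇒square-≡ : ∀ {a b} → a ≡± b ⟨mod n ⟩ → a * a ≡ b * b ⟨mod n ⟩
  ≡±⇒square-≡ (inj₁ a≡b) = ≡mod-* a≡b a≡b
  ≡±⇒square-≡ {b = b} (inj₂ a≡-b) = ≡mod-trans (≡mod-* a≡-b a≡-b) (≡mod-reflexive (lemma b))
    where lemma : ∀ b → - b * - b ≡ b * b
          lemma = solve-∀

module _ {A : Set} (_≟_ : DecidableEquality A) where

  without : A → List A → List A
  without a = filter (λ x → ¬? (x ≟ a))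

  module _ {a : A} {xs : List A} where

    ∈-without⁺ : ∀ {x} → x ∈ xs → x ≢ a → x ∈ without a xs
    ∈-without⁺ = ∈-filter⁺ (λ x → ¬? (x ≟ a))

    ∈-without⁻ : ∀ {x} → x ∈ without a xs → x ∈ xs × x ≢ a
    ∈-without⁻ = ∈-filter⁻ (λ x → ¬? (x ≟ a))

    without-unique : Unique xs → Unique (without a xs)
    without-unique = Unique.filter⁺ (λ x → ¬? (x ≟ a))

  length-without : ∀ {a xs} → Unique xs → a ∈ xs → suc (length (without a xs)) ≡ length xs
  length-without {a} {x ∷ xs} (x∉xs ∷ _) (here refl)
    rewrite filter-reject (λ x → ¬? (x ≟ a)) {x} {xs} (λ x≢a → x≢a refl)
          | filter-all (λ x → ¬? (x ≟ a)) (All.map (λ a≢y y≡a → a≢y (sym y≡a)) x∉xs) = refl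
  length-without {a} {x ∷ xs} (x∉xs ∷ u) (there a∈xs)
    rewrite filter-accept (λ x → ¬? (x ≟ a)) {x} {xs} (lookup x∉xs a∈xs) =
    cong suc (length-without u a∈xs)

  involution-fixedPoint : (σ : A → A) → ∀ k {xs} → length xs ≡ suc (k ℕ.+ k) → Unique xs →
    (∀ {x} → x ∈ xs → σ x ∈ xs) → (∀ {x} → x ∈ xs → σ (σ x) ≡ x) →
    ∃[ x ] x ∈ xs × σ x ≡ x
  involution-fixedPoint σ zero {x ∷ []} _ _ closed _ with closed (here refl)
  ... | here σx≡x = x , here refl , σx≡x
  involution-fixedPoint σ (suc k) {x ∷ ys} len (x∉ys ∷ ys-unique) closed invol
    with σ x ≟ x
  ... | yes σx≡x = x , here refl , σx≡x
  ... | no σx≢x with closed (here refl)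
  ...   | here σx≡x = ⊥-elim (σx≢x σx≡x)
  ...   | there σx∈ys =
    let z , z∈ , σz≡z = involution-fixedPoint σ k len′ (without-unique ys-unique) closed′
                          (λ y∈ → invol (there (∈-ys y∈)))
    in z , there (∈-ys z∈) , σz≡z
    where
    ∈-ys : ∀ {y} → y ∈ without (σ x) ys → y ∈ ys
    ∈-ys = proj₁ ∘ ∈-without⁻
    len′ : length (without (σ x) ys) ≡ suc (k ℕ.+ k)
    len′ = trans (ℕ.suc-injective (trans (length-without ys-unique σx∈ys) (ℕ.suc-injective len)))
             (ℕ.+-suc k k)
    closed′ : ∀ {y} → y ∈ without (σ x) ys → σ y ∈ without (σ x) ys
    closed′ {y} y∈ with ∈-without⁻ y∈
    ... | y∈ys , y≢σx with closed (there y∈ys)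
    ...   | here σy≡x = ⊥-elim (y≢σx (trans (sym (invol (there y∈ys))) (cong σ σy≡x)))
    ...   | there σy∈ys = ∈-without⁺ σy∈ys σy≢σx
      where
      σy≢σx : σ y ≢ σ x
      σy≢σx σy≡σx = lookup x∉ys y∈ys
        (sym (trans (sym (invol (there y∈ys))) (trans (cong σ σy≡σx) (invol (here refl)))))

module PrimeModulus (p : ℕ) (p-prime : Prime p) where

  instance
    p-nonZero : NonZero p
    p-nonZero = prime⇒nonZero p-prime

  euclidsLemmaℤ : ∀ a b → + p ∣ a * b → + p ∣ a ⊎ + p ∣ b
  euclidsLemmaℤ a b p∣ab
    with euclidsLemma ℤ.∣ a ∣ ℤ.∣ b ∣ p-prime (subst (p ℕ.∣_) (ℤ.abs-* a b) (∣⇒∣ᵤ p∣ab))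
  ... | inj₁ p∣a = inj₁ (∣ᵤ⇒∣ p∣a)
  ... | inj₂ p∣b = inj₂ (∣ᵤ⇒∣ p∣b)

  ∤-* : ∀ {a b} → ¬ + p ∣ a → ¬ + p ∣ b → ¬ + p ∣ a * b
  ∤-* {a} {b} p∤a p∤b p∣ab with euclidsLemmaℤ a b p∣ab
  ... | inj₁ p∣a = p∤a p∣a
  ... | inj₂ p∣b = p∤b p∣b

  p≢1 : p ≢ 1
  p≢1 p≡1 = ¬prime[1] (subst Prime p≡1 p-prime)

  p∤1 : ¬ + p ∣ + 1
  p∤1 = p≢1 ∘ ℕ.∣1⇒≡1 ∘ ∣⇒∣ᵤ

  ≡mod-cancelˡ : ∀ {c a b} → ¬ + p ∣ c → c * a ≡ c * b ⟨mod p ⟩ → a ≡ b ⟨mod p ⟩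
  ≡mod-cancelˡ {c} {a} {b} p∤c (mod-divides p∣ca-cb)
    with euclidsLemmaℤ c (a - b) (subst (+ p ∣_) (lemma c a b) p∣ca-cb)
    where lemma : ∀ c a b → c * a - c * b ≡ c * (a - b)
          lemma = solve-∀
  ... | inj₁ p∣c = ⊥-elim (p∤c p∣c)
  ... | inj₂ p∣a-b = mod-divides p∣a-b

  ≡±-cancelˡ : ∀ {c a b} → ¬ + p ∣ c → c * a ≡± c * b ⟨mod p ⟩ → a ≡± b ⟨mod p ⟩
  ≡±-cancelˡ p∤c (inj₁ ca≡cb) = inj₁ (≡mod-cancelˡ p∤c ca≡cb)
  ≡±-cancelˡ {c} {b = b} p∤c (inj₂ ca≡-cb) =
    inj₂ (≡mod-cancelˡ p∤c (≡mod-trans ca≡-cb (≡mod-reflexive (ℤ.neg-distribʳ-* c b))))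

  square-≡⇒≡± : ∀ {a b} → a * a ≡ b * b ⟨mod p ⟩ → a ≡± b ⟨mod p ⟩
  square-≡⇒≡± {a} {b} (mod-divides p∣a²-b²)
    with euclidsLemmaℤ (a - b) (a + b) (subst (+ p ∣_) (lemma a b) p∣a²-b²)
    where lemma : ∀ a b → a * a - b * b ≡ (a - b) * (a + b)
          lemma = solve-∀
  ... | inj₁ p∣a-b = inj₁ (mod-divides p∣a-b)
  ... | inj₂ p∣a+b = inj₂ (mod-divides (subst (+ p ∣_) (lemma a b) p∣a+b))
    where lemma : ∀ a b → a + b ≡ a - - b
          lemma = solve-∀

  ∤⇒coprime : ∀ {x} → ¬ + p ∣ + x → Coprime x p
  ∤⇒coprime p∤x {d} (d∣x , d∣p) with prime⇒irreducible p-prime d∣p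
  ... | inj₁ d≡1 = d≡1
  ... | inj₂ refl = ⊥-elim (p∤x (∣ᵤ⇒∣ d∣x))

  ∤⇒coprime-^ : ∀ k {x} → ¬ + p ∣ + x → Coprime x (p ^ k)
  ∤⇒coprime-^ zero p∤x (_ , d∣1) = ℕ.∣1⇒≡1 d∣1
  ∤⇒coprime-^ (suc k) {x} p∤x {d} (d∣x , d∣p*pᵏ) =
    ∤⇒coprime-^ k p∤x (d∣x , coprime-divisor d⊥p d∣p*pᵏ)
    where
    d⊥p : Coprime d p
    d⊥p (e∣d , e∣p) = ∤⇒coprime p∤x (ℕ.∣-trans e∣d d∣x , e∣p)

  coprime-^⇒∤ : ∀ k {x} → Coprime x (p ^ suc k) → ¬ + p ∣ + x
  coprime-^⇒∤ k x⊥pᵏ⁺¹ p∣x = p≢1 (x⊥pᵏ⁺¹ (∣⇒∣ᵤ p∣x , ℕ.∣m⇒∣m*n _ ℕ.∣-refl))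

  private
    pos-1+* : ∀ m n → + (1 ℕ.+ m ℕ.* n) ≡ 1ℤ + + m * + n
    pos-1+* m n = trans (ℤ.pos-+ 1 (m ℕ.* n)) (cong (_+_ 1ℤ) (ℤ.pos-* m n))

  coprime⇒invertible : ∀ {r} → Coprime r p → ∃[ u ] u * + r ≡ 1ℤ ⟨mod p ⟩
  coprime⇒invertible {r} r⊥p with coprime-Bézout r⊥p
  ... | Bézout.+- x y 1+yp≡xr = + x , (begin
    + x * + r          ≡⟨ ℤ.pos-* x r ⟨
    + (x ℕ.* r)        ≡⟨ cong +_ 1+yp≡xr ⟨
    + (1 ℕ.+ y ℕ.* p)  ≡⟨ pos-1+* y p ⟩
    1ℤ + + y * + p    ≈⟨ +-*-≡mod (1ℤ) (+ y) ⟩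
    1ℤ                ∎)
    where open ≡mod-Reasoning p
  ... | Bézout.-+ x y 1+xr≡yp = - + x , (begin
    - + x * + r                   ≡⟨ lemma (+ x) (+ r) ⟩
    1ℤ + - (1ℤ + + x * + r)     ≡⟨ cong (λ z → 1ℤ + - z) (trans (sym (pos-1+* x r)) (cong +_ 1+xr≡yp)) ⟩
    1ℤ + - + (y ℕ.* p)           ≡⟨ cong (λ z → 1ℤ + - z) (ℤ.pos-* y p) ⟩
    1ℤ + - (+ y * + p)           ≡⟨ cong (_+_ 1ℤ) (ℤ.neg-distribˡ-* (+ y) (+ p)) ⟩
    1ℤ + - + y * + p             ≈⟨ +-*-≡mod (1ℤ) (- + y) ⟩
    1ℤ                           ∎)
    where
    open ≡mod-Reasoning p
    lemma : ∀ x r → - x * r ≡ 1ℤ + - (1ℤ + x * r)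
    lemma = solve-∀

  inverse : ∀ {a} → ¬ + p ∣ a → ∃[ u ] u * a ≡ 1ℤ ⟨mod p ⟩
  inverse {a} p∤a =
    let u , ur≡1 = coprime⇒invertible (∤⇒coprime (p∤a ∘ ≡mod-∣ (≡mod-sym r≡a)))
    in u , ≡mod-trans (≡mod-*ˡ u (≡mod-sym r≡a)) ur≡1
    where
    r≡a : + (a %ℕ p) ≡ a ⟨mod p ⟩
    r≡a = %ℕ-≡mod a

  invertible⇒∤ : ∀ {u a} → u * a ≡ 1ℤ ⟨mod p ⟩ → ¬ + p ∣ u
  invertible⇒∤ {u} {a} ua≡1 p∣u = p∤1 (≡mod-∣ (≡mod-sym ua≡1) (∣m⇒∣m*n a p∣u))

  UnitSquare : ℕ → ℤ → Set
  UnitSquare m d = ∃[ x ] ¬ + p ∣ x × d ≡ x * x ⟨mod m ⟩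

  unitSquare-∤ : ∀ {d} → UnitSquare p d → ¬ + p ∣ d
  unitSquare-∤ (x , p∤x , d≡x²) p∣d = ∤-* p∤x p∤x (≡mod-∣ (≡mod-sym d≡x²) p∣d)

  unitSquare-resp : ∀ {m d e} → d ≡ e ⟨mod m ⟩ → UnitSquare m e → UnitSquare m d
  unitSquare-resp d≡e (x , p∤x , e≡x²) = x , p∤x , ≡mod-trans d≡e e≡x²

  unitSquare-* : ∀ {m a b} → UnitSquare m a → UnitSquare m b → UnitSquare m (a * b)
  unitSquare-* (x , p∤x , a≡x²) (y , p∤y , b≡y²) =
    x * y , ∤-* p∤x p∤y , ≡mod-trans (≡mod-* a≡x² b≡y²) (≡mod-reflexive (lemma x y))
    where lemma : ∀ x y → x * x * (y * y) ≡ x * y * (x * y)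
          lemma = solve-∀

  module _ (p∤2 : ¬ + p ∣ + 2) where

    -- Newton's step: if d ≡ x² (mod M) with M = p^(k+1), then z = x + u t M, where
    -- d - x² = t M and u is an inverse of 2x modulo p, satisfies d ≡ z² (mod p M).
    unitSquare-lift : ∀ k {d} → UnitSquare (p ^ suc k) d → UnitSquare (p ^ suc (suc k)) d
    unitSquare-lift k {d} (x , p∤x , mod-divides (divides t d-x²≡tM)) = z , p∤z , ≡mod-sym z²≡d
      where
      M = p ^ suc k
      u = proj₁ (inverse (∤-* p∤2 p∤x))
      u2x≡1 : u * (+ 2 * x) ≡ 1ℤ ⟨mod p ⟩
      u2x≡1 = proj₂ (inverse (∤-* p∤2 p∤x))
      z = x + u * t * + M
      p∣M : + p ∣ + M
      p∣M = ∣ᵤ⇒∣ (ℕ.∣m⇒∣m*n _ ℕ.∣-refl)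
      p∤z : ¬ + p ∣ z
      p∤z p∣z = p∤x (∣m+n∣n⇒∣m p∣z (∣n⇒∣m*n (u * t) p∣M))
      pM∣M² : + (p ℕ.* M) ∣ + M * + M
      pM∣M² = divides (+ (p ^ k))
        (trans (sym (ℤ.pos-* M M)) (trans (cong +_ (lemma p (p ^ k))) (ℤ.pos-* (p ^ k) (p ℕ.* M))))
        where lemma : ∀ p q → (p ℕ.* q) ℕ.* (p ℕ.* q) ≡ q ℕ.* (p ℕ.* (p ℕ.* q))
              lemma = NatSolver.solve-∀
      z²≡d : z * z ≡ d ⟨mod p ℕ.* M ⟩
      z²≡d = begin
        z * z                                                       ≡⟨ expand x u t (+ M) ⟩
        x * x + u * (+ 2 * x) * t * + M + u * t * (u * t) * (+ M * + M)
          ≈⟨ ≡mod-+ˡ (x * x + u * (+ 2 * x) * t * + M) (∣⇒≡mod-0 (∣n⇒∣m*n (u * t * (u * t)) pM∣M²)) ⟩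
        x * x + u * (+ 2 * x) * t * + M + 0ℤ                        ≡⟨ ℤ.+-identityʳ _ ⟩
        x * x + u * (+ 2 * x) * t * + M                             ≈⟨ ≡mod-+ˡ (x * x) (≡mod-*-modulus M (≡mod-*ʳ t u2x≡1)) ⟩
        x * x + 1ℤ * t * + M                                        ≡⟨ cong (λ v → x * x + v * + M) (ℤ.*-identityˡ t) ⟩
        x * x + t * + M                                             ≡⟨ cong (_+_ (x * x)) d-x²≡tM ⟨
        x * x + (d - x * x)                                         ≡⟨ cancel (x * x) d ⟩
        d                                                           ∎
        where
        open ≡mod-Reasoning (p ℕ.* M)
        expand : ∀ x u t M → (x + u * t * M) * (x + u * t * M) ≡
                 x * x + u * (+ 2 * x) * t * M + u * t * (u * t) * (M * M)
        expand = solve-∀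
        cancel : ∀ a d → a + (d - a) ≡ d
        cancel = solve-∀

    hensel : ∀ k {d} → UnitSquare p d → UnitSquare (p ^ suc k) d
    hensel zero = subst (λ m → UnitSquare m _) (sym (ℕ.*-identityʳ p))
    hensel (suc k) = unitSquare-lift k ∘ hensel k

module HalfSystem (p : ℕ) (p-prime : Prime p) (h : ℕ) (p≡1+2h : p ≡ suc (h ℕ.+ h)) where

  open PrimeModulus p p-prime

  h<p : h < p
  h<p = subst (h <_) (sym p≡1+2h) (s≤s (ℕ.m≤m+n h h))

  2h<p : h ℕ.+ h < p
  2h<p = subst (h ℕ.+ h <_) (sym p≡1+2h) ℕ.≤-refl

  0<h : 0 < h
  0<h = ℕ.n≢0⇒n>0 λ { refl → p≢1 p≡1+2h }

  p∤2 : ¬ + p ∣ + 2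
  p∤2 p∣2 = ℕ.<⇒≱ (ℕ.≤-<-trans (ℕ.+-mono-≤ 0<h 0<h) 2h<p) (ℕ.∣⇒≤ (∣⇒∣ᵤ p∣2))

  -- Fin h indexes the half system {1, …, h} of representatives of the units up to sign.
  ⟦_⟧ : Fin h → ℤ
  ⟦ j ⟧ = + suc (toℕ j)

  ⟦⟧<p : ∀ j → suc (toℕ j) < p
  ⟦⟧<p j = ℕ.≤-<-trans (Fin.toℕ<n j) h<p

  ⟦⟧-∤ : ∀ j → ¬ + p ∣ ⟦ j ⟧
  ⟦⟧-∤ j p∣⟦j⟧ with ≡mod⇒≡ (⟦⟧<p j) (ℕ.≤-<-trans z≤n h<p) (∣⇒≡mod-0 p∣⟦j⟧)
  ... | ()

  ⟦⟧-≡±-injective : ∀ {j j′} → ⟦ j ⟧ ≡± ⟦ j′ ⟧ ⟨mod p ⟩ → j ≡ j′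
  ⟦⟧-≡±-injective {j} {j′} (inj₁ ⟦j⟧≡⟦j′⟧) =
    Fin.toℕ-injective (ℕ.suc-injective (≡mod⇒≡ (⟦⟧<p j) (⟦⟧<p j′) ⟦j⟧≡⟦j′⟧))
  ⟦⟧-≡±-injective {j} {j′} (inj₂ ⟦j⟧≡-⟦j′⟧) with ≡mod⇒≡ sum<p (ℕ.≤-<-trans z≤n h<p) sum≡0
    where
    sum<p : suc (toℕ j) ℕ.+ suc (toℕ j′) < p
    sum<p = ℕ.≤-<-trans (ℕ.+-mono-≤ (Fin.toℕ<n j) (Fin.toℕ<n j′)) 2h<p
    sum≡0 : + (suc (toℕ j) ℕ.+ suc (toℕ j′)) ≡ 0ℤ ⟨mod p ⟩
    sum≡0 = ≡mod-trans (≡mod-reflexive (ℤ.pos-+ (suc (toℕ j)) (suc (toℕ j′))))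
              (≡mod-trans (≡mod-+ʳ ⟦ j′ ⟧ ⟦j⟧≡-⟦j′⟧) (≡mod-reflexive (ℤ.+-inverseˡ ⟦ j′ ⟧)))
  ... | ()

  ⟦⟧-surjective : ∀ {x} → 0 < x → x ≤ h → ∃[ j ] ⟦ j ⟧ ≡ + x
  ⟦⟧-surjective {suc x} _ x<h = fromℕ< x<h , cong (+_ ∘ suc) (Fin.toℕ-fromℕ< x<h)

  residue-≡±-⟦⟧ : ∀ {r} → r < p → 0 < r → ∃[ j ] + r ≡± ⟦ j ⟧ ⟨mod p ⟩
  residue-≡±-⟦⟧ {r} r<p 0<r with r ℕ.≤? h
  ... | yes r≤h = map₂ (inj₁ ∘ ≡mod-reflexive ∘ sym) (⟦⟧-surjective 0<r r≤h)
  ... | no r≰h =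
    map₂ (λ ⟦j⟧≡p∸r → inj₂ (≡mod-trans r≡-[p∸r] (≡mod-reflexive (cong -_ (sym ⟦j⟧≡p∸r)))))
         (⟦⟧-surjective (ℕ.m<n⇒0<n∸m r<p) p∸r≤h)
    where
    p∸r≤h : p ∸ r ≤ h
    p∸r≤h = ℕ.≤-trans (ℕ.∸-monoʳ-≤ p (ℕ.≰⇒> r≰h))
              (ℕ.≤-reflexive (trans (cong (_∸ suc h) p≡1+2h) (ℕ.m+n∸m≡n h h)))
    r≡-[p∸r] : + r ≡ - + (p ∸ r) ⟨mod p ⟩
    r≡-[p∸r] = begin
      + r                    ≈⟨ +-*-≡mod (+ r) -1ℤ ⟨
      + r + -1ℤ * + p        ≡⟨ lemma (+ p) (+ r) ⟩
      - (+ p - + r)          ≡⟨ cong -_ (trans (ℤ.m-n≡m⊖n p r) (ℤ.⊖-≥ (ℕ.<⇒≤ r<p))) ⟩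
      - + (p ∸ r)            ∎
      where
      open ≡mod-Reasoning p
      lemma : ∀ p r → r + -1ℤ * p ≡ - (p - r)
      lemma = solve-∀

  ≡±-⟦⟧ : ∀ {a} → ¬ + p ∣ a → ∃[ j ] a ≡± ⟦ j ⟧ ⟨mod p ⟩
  ≡±-⟦⟧ {a} p∤a = map₂ (≡±-trans (inj₁ (≡mod-sym r≡a))) (residue-≡±-⟦⟧ (n%ℕd<d a p) 0<r)
    where
    r≡a : + (a %ℕ p) ≡ a ⟨mod p ⟩
    r≡a = %ℕ-≡mod a
    0<r : 0 < a %ℕ p
    0<r = ℕ.n≢0⇒n>0 λ r≡0 →
      p∤a (≡mod-∣ (≡mod-sym r≡a) (subst (λ r → + p ∣ + r) (sym r≡0) (divides 0ℤ refl)))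


  ⟦⟧²-injective : ∀ {j j′} → ⟦ j ⟧ * ⟦ j ⟧ ≡ ⟦ j′ ⟧ * ⟦ j′ ⟧ ⟨mod p ⟩ → j ≡ j′
  ⟦⟧²-injective = ⟦⟧-≡±-injective ∘ square-≡⇒≡±

  unitSquare⇒≡⟦⟧² : ∀ {d} → UnitSquare p d → ∃[ j ] d ≡ ⟦ j ⟧ * ⟦ j ⟧ ⟨mod p ⟩
  unitSquare⇒≡⟦⟧² (x , p∤x , d≡x²) = map₂ (≡mod-trans d≡x² ∘ ≡±⇒square-≡) (≡±-⟦⟧ p∤x)

  ⟦⟧²-unitSquare : ∀ j → UnitSquare p (⟦ j ⟧ * ⟦ j ⟧)
  ⟦⟧²-unitSquare j = ⟦ j ⟧ , ⟦⟧-∤ j , ≡mod-refl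

  -- Opaque: unfolding the Bézout witness hidden in partner makes type checking diverge.
  opaque
    partnerOf : ∀ j → ∃[ j′ ] ⟦ j ⟧ * ⟦ j′ ⟧ ≡± 1ℤ ⟨mod p ⟩
    partnerOf j =
      let u , u⟦j⟧≡1 = inverse (⟦⟧-∤ j)
          j′ , u≡±⟦j′⟧ = ≡±-⟦⟧ (invertible⇒∤ {a = ⟦ j ⟧} u⟦j⟧≡1)
      in j′ , ≡±-trans (≡±-*ˡ ⟦ j ⟧ (≡±-sym u≡±⟦j′⟧))
                       (inj₁ (≡mod-trans (≡mod-reflexive (ℤ.*-comm ⟦ j ⟧ u)) u⟦j⟧≡1))

  partner : Fin h → Fin h
  partner = proj₁ ∘ partnerOf

  partner-spec : ∀ j → ⟦ j ⟧ * ⟦ partner j ⟧ ≡± 1ℤ ⟨mod p ⟩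
  partner-spec = proj₂ ∘ partnerOf

  partner-unique : ∀ {j k} → ⟦ j ⟧ * ⟦ k ⟧ ≡± 1ℤ ⟨mod p ⟩ → partner j ≡ k
  partner-unique {j} jk≡±1 =
    ⟦⟧-≡±-injective (≡±-cancelˡ (⟦⟧-∤ j) (≡±-trans (partner-spec j) (≡±-sym jk≡±1)))

  partner-involutive : ∀ j → partner (partner j) ≡ j
  partner-involutive j =
    partner-unique (≡±-trans (inj₁ (≡mod-reflexive (ℤ.*-comm ⟦ partner j ⟧ ⟦ j ⟧))) (partner-spec j))

  one : Fin h
  one = fromℕ< 0<h

  ⟦one⟧≡1 : ⟦ one ⟧ ≡ 1ℤ
  ⟦one⟧≡1 = cong (+_ ∘ suc) (Fin.toℕ-fromℕ< 0<h)

  partner-one : partner one ≡ one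
  partner-one = partner-unique (inj₁ (≡mod-reflexive (cong (λ x → x * x) ⟦one⟧≡1)))

  partner-fixed : ∀ {j} → partner j ≡ j → j ≡ one ⊎ (⟦ j ⟧ * ⟦ j ⟧ ≡ -1ℤ ⟨mod p ⟩)
  partner-fixed {j} partner-j≡j =
    Sum.map₁ (λ ⟦j⟧²≡1 → ⟦⟧²-injective
                 (≡mod-trans ⟦j⟧²≡1 (≡mod-reflexive (cong (λ x → x * x) (sym ⟦one⟧≡1)))))
             (subst (λ k → ⟦ j ⟧ * ⟦ k ⟧ ≡± 1ℤ ⟨mod p ⟩) partner-j≡j (partner-spec j))

  -1-unitSquare : ∀ c → h ≡ suc c ℕ.+ suc c → UnitSquare p -1ℤ
  -1-unitSquare c h≡2+2c =
    let j , j∈xs , partner-j≡j = involution-fixedPoint Fin._≟_ partner c length-xs xs-unique closed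
                                   (λ _ → partner-involutive _)
    in [ (λ j≡one → ⊥-elim (≢one j∈xs j≡one))
       , (λ ⟦j⟧²≡-1 → ⟦ j ⟧ , ⟦⟧-∤ j , ≡mod-sym ⟦j⟧²≡-1)
       ] (partner-fixed partner-j≡j)
    where
    xs = without Fin._≟_ one (allFin h)
    xs-unique = without-unique Fin._≟_ (Unique.allFin⁺ h)
    ≢one : ∀ {j} → j ∈ xs → j ≢ one
    ≢one = proj₂ ∘ ∈-without⁻ Fin._≟_ {xs = allFin h}
    length-xs : length xs ≡ suc (c ℕ.+ c)
    length-xs = trans (ℕ.suc-injective (trans (length-without Fin._≟_ (Unique.allFin⁺ h) (∈-allFin one))
                  (trans (length-tabulate (λ j → j)) h≡2+2c))) (ℕ.+-suc c c)
    closed : ∀ {j} → j ∈ xs → partner j ∈ xs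
    closed {j} j∈xs = ∈-without⁺ Fin._≟_ (∈-allFin (partner j)) λ partner-j≡one →
      ≢one j∈xs (trans (sym (partner-involutive j)) (trans (cong partner partner-j≡one) partner-one))

triangle : ℕ → ℕ
triangle zero    = 0
triangle (suc m) = triangle m ℕ.+ m

pair : ∀ m → Fin (triangle m) → Fin m × Fin m
pair (suc m) t with splitAt (triangle m) t
... | inj₁ t′ = inject₁ (proj₁ (pair m t′)) , inject₁ (proj₂ (pair m t′))
... | inj₂ k  = inject₁ k , fromℕ m

pair-< : ∀ m (t : Fin (triangle m)) → toℕ (proj₁ (pair m t)) < toℕ (proj₂ (pair m t))
pair-< (suc m) t with splitAt (triangle m) t
... | inj₁ t′ = subst₂ _<_ (sym (Fin.toℕ-inject₁ _)) (sym (Fin.toℕ-inject₁ _)) (pair-< m t′)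
... | inj₂ k  = subst₂ _<_ (sym (Fin.toℕ-inject₁ k)) (sym (Fin.toℕ-fromℕ m)) (Fin.toℕ<n k)

splitAt-injective : ∀ m {n} {u u′ : Fin (m ℕ.+ n)} → splitAt m u ≡ splitAt m u′ → u ≡ u′
splitAt-injective m {n} {u} {u′} eq =
  trans (sym (Fin.join-splitAt m n u)) (trans (cong (join m n) eq) (Fin.join-splitAt m n u′))

pair-injective : ∀ m {t t′} → pair m t ≡ pair m t′ → t ≡ t′
pair-injective (suc m) {t} {t′} eq
  with splitAt (triangle m) t in split-t | splitAt (triangle m) t′ in split-t′
... | inj₁ s | inj₁ s′ = splitAt-injective (triangle m) (trans split-t (trans (cong inj₁ s≡s′) (sym split-t′)))
  where
  s≡s′ : s ≡ s′
  s≡s′ = pair-injective m (cong₂ _,_ (Fin.inject₁-injective (cong proj₁ eq))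
                                      (Fin.inject₁-injective (cong proj₂ eq)))
... | inj₂ k | inj₂ k′ = splitAt-injective (triangle m)
  (trans split-t (trans (cong inj₂ (Fin.inject₁-injective (cong proj₁ eq))) (sym split-t′)))
... | inj₁ s | inj₂ k′ =
  ⊥-elim (Fin.toℕ-inject₁-≢ _ (trans (sym (Fin.toℕ-fromℕ m)) (sym (cong (toℕ ∘ proj₂) eq))))
... | inj₂ k | inj₁ s′ =
  ⊥-elim (Fin.toℕ-inject₁-≢ _ (trans (sym (Fin.toℕ-fromℕ m)) (cong (toℕ ∘ proj₂) eq)))

≢last⇒< : ∀ {m} (l : Fin (suc m)) → toℕ l ≢ m → toℕ l < m
≢last⇒< l = ℕ.≤∧≢⇒< (ℕ.s≤s⁻¹ (Fin.toℕ<n l))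

inject₁-fromℕ< : ∀ {m} (k : Fin (suc m)) .(k<m : toℕ k < m) → inject₁ (fromℕ< k<m) ≡ k
inject₁-fromℕ< k k<m = Fin.toℕ-injective (trans (Fin.toℕ-inject₁ _) (Fin.toℕ-fromℕ< k<m))

unpair : ∀ m (k l : Fin m) → .(toℕ k < toℕ l) → Fin (triangle m)
unpair (suc m) k l k<l with toℕ l ℕ.≟ m
... | yes l≡m = triangle m ↑ʳ fromℕ< (subst (toℕ k <_) l≡m k<l)
... | no l≢m  = unpair m (fromℕ< (ℕ.<-trans k<l (≢last⇒< l l≢m))) (fromℕ< (≢last⇒< l l≢m))
                  (subst₂ _<_ (sym (Fin.toℕ-fromℕ< _)) (sym (Fin.toℕ-fromℕ< _)) k<l) ↑ˡ m

pair-↑ˡ : ∀ m t → pair (suc m) (t ↑ˡ m) ≡ (inject₁ (proj₁ (pair m t)) , inject₁ (proj₂ (pair m t)))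
pair-↑ˡ m t rewrite Fin.splitAt-↑ˡ (triangle m) t m = refl

pair-↑ʳ : ∀ m k → pair (suc m) (triangle m ↑ʳ k) ≡ (inject₁ k , fromℕ m)
pair-↑ʳ m k rewrite Fin.splitAt-↑ʳ (triangle m) m k = refl

pair-unpair : ∀ m (k l : Fin m) .(k<l : toℕ k < toℕ l) → pair m (unpair m k l k<l) ≡ (k , l)
pair-unpair (suc m) k l k<l with toℕ l ℕ.≟ m
... | yes l≡m = trans (pair-↑ʳ m _)
  (cong₂ _,_ (inject₁-fromℕ< k _) (Fin.toℕ-injective (trans (Fin.toℕ-fromℕ m) (sym l≡m))))
... | no l≢m = trans (pair-↑ˡ m _)
  (trans (cong (λ (k , l) → inject₁ k , inject₁ l) (pair-unpair m _ _ _))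
         (cong₂ _,_ (inject₁-fromℕ< k _) (inject₁-fromℕ< l _)))

triangle-double : ∀ m → triangle (suc m) ℕ.+ triangle (suc m) ≡ suc m ℕ.* m
triangle-double zero    = refl
triangle-double (suc m) = begin
  (t ℕ.+ suc m) ℕ.+ (t ℕ.+ suc m)      ≡⟨ regroup t (suc m) ⟩
  (t ℕ.+ t) ℕ.+ (suc m ℕ.+ suc m)      ≡⟨ cong (ℕ._+ (suc m ℕ.+ suc m)) (triangle-double m) ⟩
  suc m ℕ.* m ℕ.+ (suc m ℕ.+ suc m)    ≡⟨ expand m ⟩
  suc (suc m) ℕ.* suc m                ∎
  where
  open ≡-Reasoning
  t = triangle (suc m)
  regroup : ∀ a b → (a ℕ.+ b) ℕ.+ (a ℕ.+ b) ≡ (a ℕ.+ a) ℕ.+ (b ℕ.+ b)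
  regroup = NatSolver.solve-∀
  expand : ∀ m → suc m ℕ.* m ℕ.+ (suc m ℕ.+ suc m) ≡ suc (suc m) ℕ.* suc m
  expand = NatSolver.solve-∀

triangle≡ : ∀ m → triangle m ≡ m ℕ.* (m ∸ 1) ℕ./ 2
triangle≡ zero    = refl
triangle≡ (suc m) = sym (begin
  suc m ℕ.* m ℕ./ 2                                    ≡⟨ cong (ℕ._/ 2) (triangle-double m) ⟨
  (triangle (suc m) ℕ.+ triangle (suc m)) ℕ./ 2        ≡⟨ cong (ℕ._/ 2) (double (triangle (suc m))) ⟩
  triangle (suc m) ℕ.* 2 ℕ./ 2                         ≡⟨ m*n/n≡m (triangle (suc m)) 2 ⟩
  triangle (suc m)                                     ∎)
  where
  open ≡-Reasoning
  double : ∀ a → a ℕ.+ a ≡ a ℕ.* 2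
  double = NatSolver.solve-∀

-- Fin (m (m - 1) / 2) enumerates the pairs k < l in Fin m.
ends : ∀ m → Fin (m ℕ.* (m ∸ 1) ℕ./ 2) → Fin m × Fin m
ends m t = pair m (cast (sym (triangle≡ m)) t)

ends-< : ∀ m t → toℕ (proj₁ (ends m t)) < toℕ (proj₂ (ends m t))
ends-< m t = pair-< m (cast (sym (triangle≡ m)) t)

index : ∀ m (k l : Fin m) → .(toℕ k < toℕ l) → Fin (m ℕ.* (m ∸ 1) ℕ./ 2)
index m k l k<l = cast (triangle≡ m) (unpair m k l k<l)

ends-index : ∀ m (k l : Fin m) .(k<l : toℕ k < toℕ l) → ends m (index m k l k<l) ≡ (k , l)
ends-index m k l k<l = trans (cong (pair m) (Fin.cast-involutive (sym (triangle≡ m)) (triangle≡ m) _))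
                             (pair-unpair m k l k<l)

index-ends : ∀ m t → index m (proj₁ (ends m t)) (proj₂ (ends m t)) (ends-< m t) ≡ t
index-ends m t = trans (cong (cast (triangle≡ m)) (pair-injective m (pair-unpair m _ _ _)))
                       (Fin.cast-involutive (triangle≡ m) (sym (triangle≡ m)) t)

index-cong : ∀ m {k k′ l l′ : Fin m} .{k<l : toℕ k < toℕ l} .{k′<l′ : toℕ k′ < toℕ l′} →
             k ≡ k′ → l ≡ l′ → index m k l k<l ≡ index m k′ l′ k′<l′
index-cong m refl refl = refl

Δ : ∀ {n} → Fin n → Fin n → ℤ
Δ a b = + toℕ a - + toℕ b

Δ-antisym : ∀ {n} (a b : Fin n) → Δ a b ≡ - Δ b a
Δ-antisym a b = lemma (+ toℕ a) (+ toℕ b)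
  where lemma : ∀ x y → x - y ≡ - (y - x)
        lemma = solve-∀

∣Δ⇒≡ : ∀ {n} {a b : Fin n} → + n ∣ Δ a b → a ≡ b
∣Δ⇒≡ {a = a} {b} n∣Δ = Fin.toℕ-injective (≡mod⇒≡ (Fin.toℕ<n a) (Fin.toℕ<n b) (mod-divides n∣Δ))

Δ-cancelʳ : ∀ {n} {a b c : Fin n} → Δ a c ≡ Δ b c ⟨mod n ⟩ → a ≡ b
Δ-cancelʳ {a = a} {b} {c} Δac≡Δbc = Fin.toℕ-injective (≡mod⇒≡ (Fin.toℕ<n a) (Fin.toℕ<n b)
  (subst₂ (_≡_⟨mod _ ⟩) (lemma (+ toℕ a) (+ toℕ c)) (lemma (+ toℕ b) (+ toℕ c))
          (≡mod-+ʳ (+ toℕ c) Δac≡Δbc)))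
  where lemma : ∀ x y → x - y + y ≡ x
        lemma = solve-∀

-- Fin (p * m) as m layers of p consecutive vertices: vertex k r is p k + r.
module Layers (p m : ℕ) where

  private
    m*p≡p*m : m ℕ.* p ≡ p ℕ.* m
    m*p≡p*m = ℕ.*-comm m p

  vertex : Fin m → Fin p → Fin (p ℕ.* m)
  vertex k r = cast m*p≡p*m (combine k r)

  layer : Fin (p ℕ.* m) → Fin m
  layer a = proj₁ (remQuot {m} p (cast (sym m*p≡p*m) a))

  residue : Fin (p ℕ.* m) → Fin p
  residue a = proj₂ (remQuot {m} p (cast (sym m*p≡p*m) a))

  vertex-layer-residue : ∀ a → vertex (layer a) (residue a) ≡ a
  vertex-layer-residue a = trans (cong (cast m*p≡p*m) (Fin.combine-remQuot {m} p (cast (sym m*p≡p*m) a)))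
                                 (Fin.cast-involutive m*p≡p*m (sym m*p≡p*m) a)

  private
    remQuot-vertex : ∀ k r → remQuot {m} p (cast (sym m*p≡p*m) (vertex k r)) ≡ (k , r)
    remQuot-vertex k r = trans (cong (remQuot {m} p) (Fin.cast-involutive (sym m*p≡p*m) m*p≡p*m (combine k r)))
                               (Fin.remQuot-combine k r)

  layer-vertex : ∀ k r → layer (vertex k r) ≡ k
  layer-vertex k r = cong proj₁ (remQuot-vertex k r)

  residue-vertex : ∀ k r → residue (vertex k r) ≡ r
  residue-vertex k r = cong proj₂ (remQuot-vertex k r)

  toℕ-vertex : ∀ k r → toℕ (vertex k r) ≡ p ℕ.* toℕ k ℕ.+ toℕ r
  toℕ-vertex k r = trans (Fin.toℕ-cast m*p≡p*m (combine k r)) (Fin.toℕ-combine k r)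

  Δ-vertex : ∀ k l r s → Δ (vertex k r) (vertex l s) ≡ Δ r s ⟨mod p ⟩
  Δ-vertex k l r s = begin
    Δ (vertex k r) (vertex l s)                              ≡⟨ cong₂ _-_ (toℤ-vertex k r) (toℤ-vertex l s) ⟩
    (+ p * + toℕ k + + toℕ r) - (+ p * + toℕ l + + toℕ s)    ≡⟨ lemma (+ toℕ k) (+ toℕ l) (+ toℕ r) (+ toℕ s) (+ p) ⟩
    Δ r s + Δ k l * + p                                      ≈⟨ +-*-≡mod (Δ r s) (Δ k l) ⟩
    Δ r s                                                    ∎
    where
    open ≡mod-Reasoning p
    lemma : ∀ k l r s p → (p * k + r) - (p * l + s) ≡ (r - s) + (k - l) * p
    lemma = solve-∀
    toℤ-vertex : ∀ k r → + toℕ (vertex k r) ≡ + p * + toℕ k + + toℕ r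
    toℤ-vertex k r = trans (cong +_ (toℕ-vertex k r))
                       (trans (ℤ.pos-+ (p ℕ.* toℕ k) (toℕ r)) (cong (_+ + toℕ r) (ℤ.pos-* p (toℕ k))))

  Δ≡Δ-residue : ∀ a b → Δ a b ≡ Δ (residue a) (residue b) ⟨mod p ⟩
  Δ≡Δ-residue a b = subst₂ (λ a′ b′ → Δ a′ b′ ≡ Δ (residue a) (residue b) ⟨mod p ⟩)
    (vertex-layer-residue a) (vertex-layer-residue b) (Δ-vertex (layer a) (layer b) (residue a) (residue b))

abs-square : ∀ z → + (ℤ.∣ z ∣ ℕ.* ℤ.∣ z ∣) ≡ z * z
abs-square (+ n) = ℤ.pos-* n n
abs-square ℤ.-[1+ n ] = refl

module AdjacencyCriteria (p : ℕ) (p-prime : Prime p) (p∤2 : ¬ + p ∣ + 2) where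

  open PrimeModulus p p-prime

  private
    ≡[mod]⇒≡mod-square : ∀ {m d} x → d ≡ + (x ℕ.* x) [mod m ] → d ≡ + x * + x ⟨mod m ⟩
    ≡[mod]⇒≡mod-square x d≡x² = ≡mod-trans (≡[mod]⇒≡mod d≡x²) (≡mod-reflexive (ℤ.pos-* x x))

    ≡mod⇒≡[mod]-square : ∀ {m d} z → d ≡ z * z ⟨mod m ⟩ → d ≡ + (ℤ.∣ z ∣ ℕ.* ℤ.∣ z ∣) [mod m ]
    ≡mod⇒≡[mod]-square z d≡z² = ≡mod⇒≡[mod] (≡mod-trans d≡z² (≡mod-reflexive (sym (abs-square z))))

  Δ-∤⇒≢ : ∀ {n} {a b : Fin n} → ¬ + p ∣ Δ a b → a ≢ b
  Δ-∤⇒≢ {a = a} p∤Δ refl = p∤Δ (subst (+ p ∣_) (sym (ℤ.+-inverseʳ (+ toℕ a))) (divides 0ℤ refl))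

  Gₙ⇒unitSquare : ∀ β {a b} → Gₙ (p ^ suc β) a b → UnitSquare p (Δ a b)
  Gₙ⇒unitSquare β (_ , x , x⊥n , Δ≡x²) =
    + x , coprime-^⇒∤ β x⊥n , ≡mod-weaken (ℕ.∣m⇒∣m*n _ ℕ.∣-refl) (≡[mod]⇒≡mod-square x Δ≡x²)

  unitSquare⇒Gₙ : ∀ β {a b} → UnitSquare p (Δ a b) → Gₙ (p ^ suc β) a b
  unitSquare⇒Gₙ β sq with hensel p∤2 β sq
  ... | z , p∤z , Δ≡z² =
    Δ-∤⇒≢ (unitSquare-∤ sq) , ℤ.∣ z ∣ , ∤⇒coprime-^ (suc β) (p∤z ∘ ∣ᵤ⇒∣ ∘ ∣⇒∣ᵤ) , ≡mod⇒≡[mod]-square z Δ≡z²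

  Paley⇒unitSquare : ∀ {r s} → Paley p r s → UnitSquare p (Δ r s)
  Paley⇒unitSquare (r≢s , x , Δ≡x²) = + x , p∤x , ≡[mod]⇒≡mod-square x Δ≡x²
    where
    p∤x : ¬ + p ∣ + x
    p∤x p∣x = r≢s (∣Δ⇒≡ (≡mod-∣ (≡[mod]⇒≡mod-square x Δ≡x²) (∣m⇒∣m*n (+ x) p∣x)))

  unitSquare⇒Paley : ∀ {r s} → UnitSquare p (Δ r s) → Paley p r s
  unitSquare⇒Paley sq@(z , _ , Δ≡z²) =
    Δ-∤⇒≢ (unitSquare-∤ sq) , ℤ.∣ z ∣ , ≡mod⇒≡[mod]-square z Δ≡z²

module Decomposition37 (p : ℕ) (p-prime : Prime p)
                       (p≡1+2h : p ≡ suc ((p ∸ 1) ℕ./ 2 ℕ.+ (p ∸ 1) ℕ./ 2))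
                       (-1-square : PrimeModulus.UnitSquare p p-prime p -1ℤ) (β : ℕ) where

  h = (p ∸ 1) ℕ./ 2
  open PrimeModulus p p-prime
  open HalfSystem p p-prime h p≡1+2h
  open AdjacencyCriteria p p-prime p∤2

  m = p ^ β
  n = p ^ suc β
  open Layers p m

  shift : Fin p → Fin h → Fin p
  shift r j = fromℕ< (n%ℕd<d (+ toℕ r + ⟦ j ⟧ * ⟦ j ⟧) p)

  Δ-shift : ∀ r j → Δ (shift r j) r ≡ ⟦ j ⟧ * ⟦ j ⟧ ⟨mod p ⟩
  Δ-shift r j = begin
    + toℕ (shift r j) - + toℕ r      ≡⟨ cong (λ x → + x - + toℕ r) (Fin.toℕ-fromℕ< (n%ℕd<d sum p)) ⟩
    + (sum %ℕ p) - + toℕ r           ≈⟨ ≡mod-+ʳ (- + toℕ r) (%ℕ-≡mod sum) ⟩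
    sum - + toℕ r                    ≡⟨ lemma (+ toℕ r) ⟦ j ⟧ ⟩
    ⟦ j ⟧ * ⟦ j ⟧                     ∎
    where
    open ≡mod-Reasoning p
    sum = + toℕ r + ⟦ j ⟧ * ⟦ j ⟧
    lemma : ∀ r x → r + x * x - r ≡ x * x
    lemma = solve-∀

  shift-injective : ∀ r {j j′} → shift r j ≡ shift r j′ → j ≡ j′
  shift-injective r {j} {j′} eq = ⟦⟧²-injective
    (≡mod-trans (≡mod-sym (Δ-shift r j))
                (subst (λ s → Δ s r ≡ ⟦ j′ ⟧ * ⟦ j′ ⟧ ⟨mod p ⟩) (sym eq) (Δ-shift r j′)))

  shift-onto : ∀ r s → UnitSquare p (Δ s r) → ∃[ j ] shift r j ≡ s
  shift-onto r s sq =
    let j , Δsr≡⟦j⟧² = unitSquare⇒≡⟦⟧² sq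
    in j , Δ-cancelʳ {c = r} (≡mod-trans (Δ-shift r j) (≡mod-sym Δsr≡⟦j⟧²))

  unitSquare-neg : ∀ {d} → UnitSquare p d → UnitSquare p (- d)
  unitSquare-neg {d} = subst (UnitSquare p) (ℤ.-1*i≡-i d) ∘ unitSquare-* -1-square

  Gₙ-sym : ∀ {a b} → Gₙ n a b → Gₙ n b a
  Gₙ-sym {a} {b} =
    unitSquare⇒Gₙ β ∘ subst (UnitSquare p) (sym (Δ-antisym b a)) ∘ unitSquare-neg ∘ Gₙ⇒unitSquare β

  Gₙ⇒unitSquare-residue : ∀ {a b} → Gₙ n a b → UnitSquare p (Δ (residue a) (residue b))
  Gₙ⇒unitSquare-residue {a} {b} = unitSquare-resp (≡mod-sym (Δ≡Δ-residue a b)) ∘ Gₙ⇒unitSquare β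

  unitSquare⇒Gₙ-vertex : ∀ {k l r s} → UnitSquare p (Δ r s) → Gₙ n (vertex k r) (vertex l s)
  unitSquare⇒Gₙ-vertex {k} {l} {r} {s} = unitSquare⇒Gₙ β ∘ unitSquare-resp (Δ-vertex k l r s)

  paleyCopy : Fin m → Copy (Paley p) (Gₙ n)
  paleyCopy k = record
    { f      = vertex k
    ; f-inj  = λ r s eq → trans (sym (residue-vertex k r)) (trans (cong residue eq) (residue-vertex k s))
    ; f-edge = λ r s → unitSquare⇒Gₙ-vertex ∘ Paley⇒unitSquare
    }

  starVertex : Fin m → Fin m → Fin p → Fin (suc h) → Fin n
  starVertex k l r zero    = vertex k r
  starVertex k l r (suc j) = vertex l (shift r j)

  starCopy : ∀ (k l : Fin m) → toℕ k < toℕ l → Fin p → Copy (Star h) (Gₙ n)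
  starCopy k l k<l r = record { f = starVertex k l r ; f-inj = injective ; f-edge = edge }
    where
    k≢l : ∀ {r s} → vertex k r ≢ vertex l s
    k≢l {r} {s} eq =
      ℕ.<-irrefl (cong toℕ (trans (sym (layer-vertex k r)) (trans (cong layer eq) (layer-vertex l s)))) k<l
    injective : ∀ u v → starVertex k l r u ≡ starVertex k l r v → u ≡ v
    injective zero    zero     _  = refl
    injective zero    (suc _)  eq = ⊥-elim (k≢l eq)
    injective (suc _) zero     eq = ⊥-elim (k≢l (sym eq))
    injective (suc j) (suc j′) eq = cong suc (shift-injective r
      (trans (sym (residue-vertex l (shift r j))) (trans (cong residue eq) (residue-vertex l (shift r j′)))))
    leaf-centre : ∀ j → Gₙ n (vertex l (shift r j)) (vertex k r)
    leaf-centre j = unitSquare⇒Gₙ-vertex (unitSquare-resp (Δ-shift r j) (⟦⟧²-unitSquare j))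
    edge : ∀ u v → Star h u v → Gₙ n (starVertex k l r u) (starVertex k l r v)
    edge zero    zero    (inj₁ (_ , 0≢0)) = ⊥-elim (0≢0 refl)
    edge zero    zero    (inj₂ (_ , 0≢0)) = ⊥-elim (0≢0 refl)
    edge zero    (suc j) _                = Gₙ-sym (leaf-centre j)
    edge (suc j) zero    _                = leaf-centre j
    edge (suc _) (suc _) (inj₁ (() , _))
    edge (suc _) (suc _) (inj₂ (() , _))

  Index = Index37 p (suc β)

  copy : (i : Index) → Copy (Piece37 p (suc β) i) (Gₙ n)
  copy (inj₁ k)       = paleyCopy k
  copy (inj₂ (t , r)) = starCopy (proj₁ (ends m t)) (proj₂ (ends m t)) (ends-< m t) r

  piece : Fin n → Fin n → Index
  piece a b with Fin.<-cmp (layer a) (layer b)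
  ... | tri< a<b _ _ = inj₂ (index m (layer a) (layer b) a<b , residue a)
  ... | tri≈ _ _ _   = inj₁ (layer a)
  ... | tri> _ _ b<a = inj₂ (index m (layer b) (layer a) b<a , residue b)

  piece-≈ : ∀ {a b} → layer a ≡ layer b → piece a b ≡ inj₁ (layer a)
  piece-≈ {a} {b} eq with Fin.<-cmp (layer a) (layer b)
  ... | tri< _ a≢b _ = ⊥-elim (a≢b eq)
  ... | tri≈ _ _ _   = refl
  ... | tri> _ a≢b _ = ⊥-elim (a≢b eq)

  piece-< : ∀ {a b} (a<b : toℕ (layer a) < toℕ (layer b)) →
            piece a b ≡ inj₂ (index m (layer a) (layer b) a<b , residue a)
  piece-< {a} {b} a<b with Fin.<-cmp (layer a) (layer b)
  ... | tri< _ _ _   = refl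
  ... | tri≈ _ a≡b _ = ⊥-elim (ℕ.<-irrefl (cong toℕ a≡b) a<b)
  ... | tri> _ _ b<a = ⊥-elim (ℕ.<-asym a<b b<a)

  piece-> : ∀ {a b} (b<a : toℕ (layer b) < toℕ (layer a)) →
            piece a b ≡ inj₂ (index m (layer b) (layer a) b<a , residue b)
  piece-> {a} {b} b<a with Fin.<-cmp (layer a) (layer b)
  ... | tri< a<b _ _ = ⊥-elim (ℕ.<-asym a<b b<a)
  ... | tri≈ _ a≡b _ = ⊥-elim (ℕ.<-irrefl (cong toℕ (sym a≡b)) b<a)
  ... | tri> _ _ _   = refl

  open Copy

  piece-star : ∀ t r x → let k , l = ends m t in
               piece (vertex k r) (vertex l x) ≡ inj₂ (t , r) × piece (vertex l x) (vertex k r) ≡ inj₂ (t , r)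
  piece-star t r x =
    trans (piece-< layers-<) (cong₂ (λ t r → inj₂ (t , r)) index≡t (residue-vertex k r)) ,
    trans (piece-> layers-<) (cong₂ (λ t r → inj₂ (t , r)) index≡t (residue-vertex k r))
    where
    k = proj₁ (ends m t)
    l = proj₂ (ends m t)
    layers-< : toℕ (layer (vertex k r)) < toℕ (layer (vertex l x))
    layers-< = subst₂ (λ k l → toℕ k < toℕ l) (sym (layer-vertex k r)) (sym (layer-vertex l x)) (ends-< m t)
    index≡t : index m (layer (vertex k r)) (layer (vertex l x)) layers-< ≡ t
    index≡t = trans (index-cong m (layer-vertex k r) (layer-vertex l x)) (index-ends m t)

  piece-copy : ∀ i {u v} → Piece37 p (suc β) i u v →
               piece (f (copy i) u) (f (copy i) v) ≡ i × piece (f (copy i) v) (f (copy i) u) ≡ i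
  piece-copy (inj₁ k) {r} {s} _ =
    trans (piece-≈ (trans (layer-vertex k r) (sym (layer-vertex k s)))) (cong inj₁ (layer-vertex k r)) ,
    trans (piece-≈ (trans (layer-vertex k s) (sym (layer-vertex k r)))) (cong inj₁ (layer-vertex k s))
  piece-copy (inj₂ (t , r)) {zero}  {zero}  (inj₁ (_ , 0≢0)) = ⊥-elim (0≢0 refl)
  piece-copy (inj₂ (t , r)) {zero}  {zero}  (inj₂ (_ , 0≢0)) = ⊥-elim (0≢0 refl)
  piece-copy (inj₂ (t , r)) {zero}  {suc j} _ = piece-star t r (shift r j)
  piece-copy (inj₂ (t , r)) {suc j} {zero}  _ = swap (piece-star t r (shift r j))
  piece-copy (inj₂ (t , r)) {suc _} {suc _} (inj₁ (() , _))
  piece-copy (inj₂ (t , r)) {suc _} {suc _} (inj₂ (() , _))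

  disjoint : ∀ i j u v u′ v′ → Piece37 p (suc β) i u v → Piece37 p (suc β) j u′ v′ →
             SameEdge (f (copy i) u) (f (copy i) v) (f (copy j) u′) (f (copy j) v′) → i ≡ j
  disjoint i j u v u′ v′ edge-i edge-j (inj₁ (u≡u′ , v≡v′)) =
    trans (sym (proj₁ (piece-copy i edge-i))) (trans (cong₂ piece u≡u′ v≡v′) (proj₁ (piece-copy j edge-j)))
  disjoint i j u v u′ v′ edge-i edge-j (inj₂ (u≡v′ , v≡u′)) =
    trans (sym (proj₁ (piece-copy i edge-i))) (trans (cong₂ piece u≡v′ v≡u′) (proj₂ (piece-copy j edge-j)))

  star-through : ∀ {a b} (a<b : toℕ (layer a) < toℕ (layer b)) → Gₙ n a b →
                 let i = inj₂ (index m (layer a) (layer b) a<b , residue a) in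
                 ∃[ j ] f (copy i) zero ≡ a × f (copy i) (suc j) ≡ b
  star-through {a} {b} a<b adj =
    let j , shift≡ = shift-onto (residue a) (residue b) (Gₙ⇒unitSquare-residue (Gₙ-sym adj))
    in j , trans (cong (λ e → vertex (proj₁ e) (residue a)) ends≡) (vertex-layer-residue a)
         , trans (cong₂ (λ e s → vertex (proj₂ e) s) ends≡ shift≡) (vertex-layer-residue b)
    where ends≡ = ends-index m (layer a) (layer b) a<b

  cover : ∀ a b → Gₙ n a b →
          Σ Index λ i → ∃[ u ] ∃[ v ] (Piece37 p (suc β) i u v × f (copy i) u ≡ a × f (copy i) v ≡ b)
  cover a b adj with Fin.<-cmp (layer a) (layer b)
  ... | tri≈ _ a≡b _ =
    inj₁ (layer a) , residue a , residue b , unitSquare⇒Paley (Gₙ⇒unitSquare-residue adj) ,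
    vertex-layer-residue a , trans (cong (λ k → vertex k (residue b)) a≡b) (vertex-layer-residue b)
  ... | tri< a<b _ _ =
    let j , centre≡a , leaf≡b = star-through a<b adj
    in inj₂ (index m (layer a) (layer b) a<b , residue a) , zero , suc j ,
       inj₁ (refl , λ ()) , centre≡a , leaf≡b
  ... | tri> _ _ b<a =
    let j , centre≡b , leaf≡a = star-through b<a (Gₙ-sym adj)
    in inj₂ (index m (layer b) (layer a) b<a , residue b) , suc j , zero ,
       inj₂ (refl , λ ()) , leaf≡a , centre≡b

  decomposition : Decomposition (Gₙ n) (Vert37 p (suc β)) (Piece37 p (suc β))
  decomposition = record { copy = copy ; cover = cover ; disjoint = disjoint }

prime≡1[mod4]⇒≡1+4k : ∀ {p} → Prime p → p % 4 ≡ 1 → ∃[ c ] p ≡ suc (suc c ℕ.* 4)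
prime≡1[mod4]⇒≡1+4k {p} p-prime p%4≡1 with p ℕ./ 4 in p/4≡q
... | zero  = ⊥-elim (¬prime[1] (subst Prime p≡1+4q p-prime))
  where p≡1+4q = trans (m≡m%n+[m/n]*n p 4) (cong₂ ℕ._+_ p%4≡1 (cong (ℕ._* 4) p/4≡q))
... | suc c = c , trans (m≡m%n+[m/n]*n p 4) (cong₂ ℕ._+_ p%4≡1 (cong (ℕ._* 4) p/4≡q))

module _ (k : ℕ) where

  half[1+4k] : (suc (k ℕ.* 4) ∸ 1) ℕ./ 2 ≡ k ℕ.+ k
  half[1+4k] = trans (cong (ℕ._/ 2) (lemma k)) (m*n/n≡m (k ℕ.+ k) 2)
    where lemma : ∀ k → k ℕ.* 4 ≡ (k ℕ.+ k) ℕ.* 2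
          lemma = NatSolver.solve-∀

  1+4k≡1+2[k+k] : suc (k ℕ.* 4) ≡ suc ((k ℕ.+ k) ℕ.+ (k ℕ.+ k))
  1+4k≡1+2[k+k] = cong ℕ.suc (lemma k)
    where lemma : ∀ k → k ℕ.* 4 ≡ (k ℕ.+ k) ℕ.+ (k ℕ.+ k)
          lemma = NatSolver.solve-∀

proposition3p7 : (p α : ℕ) → Prime p → p % 4 ≡ 1 → 1 ≤ α →
    Decomposition (Gₙ (p ^ α)) (Vert37 p α) (Piece37 p α)
proposition3p7 p (suc β) p-prime p%4≡1 _ with prime≡1[mod4]⇒≡1+4k p-prime p%4≡1
... | c , refl = Decomposition37.decomposition p p-prime p≡1+2h -1-square β
  where
  h≡2+2c = half[1+4k] (suc c)
  p≡1+2h = trans (1+4k≡1+2[k+k] (suc c)) (cong ℕ.suc (sym (cong₂ ℕ._+_ h≡2+2c h≡2+2c)))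
  -1-square = HalfSystem.-1-unitSquare p p-prime _ p≡1+2h c h≡2+2c
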